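{- Let $B\ge 2$. The smallest Gaussian $B$-happy number of height $0$ is $1$, the smallest of height $1$ is $-1$, and the smallest Gaussian $B$-happy numbers of height $2$ are $i$ and $-i$.
   Context: Fix an integer $B\ge 2$. Every nonzero Gaussian integer $a+bi$ is written uniquely as $a+bi=\sum_{j=0}^n (a_j+b_ji)B^j$ with $a_j,b_j\in\mathbb{Z}$, $a_n,b_n$ not both $0$, and for each $j$: $|a_j|\le B-1$, $|b_j|\le B-1$, $\operatorname{sgn}(a)a_j\ge 0$, $\operatorname{sgn}(b)b_j\ge 0$. The Gaussian $B$-happy function $S_B:\mathbb{Z}[i]\to\mathbb{Z}[i]$ is defined by $S_B(0)=0$ and $S_B(a+bi)=\sum_{j=0}^n (a_j+b_ji)^2$. A Gaussian integer $z$ is Gaussian $B$-happy if $S_B^k(z)=1$ for some $k\ge1$. The height of a Gaussian $B$-happy number $z$ is the least $k\in\mathbb{Z}_{\ge0}$ with $S_B^k(z)=1$ ($S_B^0$ is the identity). "Smallest" means of minimal complex absolute value; the smallest numbers of a given height are all Gaussian $B$-happy numbers of that height attaining the minimal absolute value among such numbers. -}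

module Defs where

open import Data.Nat as ℕ using (ℕ; zero; suc; _<_; _≤_)
open import Data.Nat.DivMod using (_/_; _%_)
open import Data.Integer as ℤ using (ℤ; +_; -[1+_]; ∣_∣)
open import Data.List using (List; []; _∷_; upTo; map; foldr)
open import Data.Product using (_×_; Σ-syntax)
open import Relation.Binary.PropositionalEquality using (_≡_; _≢_)

record 𝔾 : Set where
  constructor _+_i
  field
    re : ℤ
    im : ℤ
open 𝔾 public

infix 5 _+_i

𝟘 𝟙 -𝟙 𝕚 -𝕚 : 𝔾
𝟘  = + 0 + + 0 i
𝟙  = + 1 + + 0 i
-𝟙 = ℤ.- (+ 1) + + 0 i
𝕚  = + 0 + + 1 i
-𝕚 = + 0 + ℤ.- (+ 1) i

_⊕_ : 𝔾 → 𝔾 → 𝔾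
(a + b i) ⊕ (c + d i) = (a ℤ.+ c) + (b ℤ.+ d) i

_⊗_ : 𝔾 → 𝔾 → 𝔾
(a + b i) ⊗ (c + d i) = (a ℤ.* c ℤ.- b ℤ.* d) + (a ℤ.* d ℤ.+ b ℤ.* c) i

sq : 𝔾 → 𝔾
sq z = z ⊗ z

normSq : 𝔾 → ℕ
normSq z = ∣ re z ∣ ℕ.* ∣ re z ∣ ℕ.+ ∣ im z ∣ ℕ.* ∣ im z ∣

iter : {A : Set} → (A → A) → ℕ → A → A
iter f zero    x = x
iter f (suc k) x = f (iter f k x)

-- j-th base-B digit of a natural number n: floor(n / B^j) mod B
-- (B = 0 is a junk case, never used since B ≥ 2 is assumed)
digit : ℕ → ℕ → ℕ → ℕ
digit zero    n j = 0
digit (suc b) n j = iter (λ x → x / suc b) j n % suc b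

sdigit : ℕ → ℤ → ℕ → ℤ
sdigit B (+ n)      j = + digit B n j
sdigit B -[1+ n ]   j = ℤ.- (+ digit B (suc n) j)

gdigit : ℕ → 𝔾 → ℕ → 𝔾
gdigit B z j = sdigit B (re z) j + sdigit B (im z) j i

-- Gaussian B-happy function: S_B(a+bi) = Σ_j (a_j + b_j i)^2.
-- Summation runs over j < |a| + |b| + 1; all digits with j beyond the
-- top index n are 0 (B^j > |a|,|b|), so extra terms contribute 0^2 = 0.
-- S_B(0) = 0 (empty digit data: all digits zero).
S : ℕ → 𝔾 → 𝔾
S B z = foldr _⊕_ 𝟘 (map (λ j → sq (gdigit B z j)) (upTo (∣ re z ∣ ℕ.+ ∣ im z ∣ ℕ.+ 1)))

Happy : ℕ → 𝔾 → Set
Happy B z = Σ[ k ∈ ℕ ] (1 ≤ k × iter (S B) k z ≡ 𝟙)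

HasHeight : ℕ → 𝔾 → ℕ → Set
HasHeight B z h = iter (S B) h z ≡ 𝟙 × (∀ k → k < h → iter (S B) k z ≢ 𝟙)

-- z is one of the smallest Gaussian B-happy numbers of height h:
-- a Gaussian B-happy number of height h whose absolute value is minimal
-- among all Gaussian B-happy numbers of height h
-- (comparing |z|^2 is equivalent to comparing |z|).
SmallestOfHeight : ℕ → ℕ → 𝔾 → Set
SmallestOfHeight B h z =
  Happy B z × HasHeight B z h ×
  (∀ w → Happy B w → HasHeight B w h → normSq z ≤ normSq w)

{-# OPTIONS --safe #-}
-- A number that reaches 1 under S_B is nonzero, since 0 is a fixed point of S_B, so its absolute
-- value is at least 1. The four units have absolute value 1 and, for B ≥ 2, are single digits:
-- S_B(±1) = 1 and S_B(±i) = -1, so their heights are 0, 1, 2, 2. Hence, whenever some unit has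
-- height h, the smallest numbers of height h are exactly the units of height h.
module Submission where

open import Defs
open import Data.Nat using (ℕ; _≤_; zero; suc; s≤s; z≤n)
open import Data.Nat.Properties using (<-cmp)
open import Data.Integer using (+_; -[1+_])
open import Data.Product using (Σ; _×_; _,_)
open import Data.Sum using (_⊎_; inj₁; inj₂)
open import Data.Empty using (⊥-elim)
open import Function.Bundles using (_⇔_; mk⇔)
open import Function.Construct.Composition using (_⇔-∘_)
open import Relation.Binary using (tri<; tri≈; tri>)
open import Relation.Binary.PropositionalEquality
  using (_≡_; _≢_; refl; sym; trans; cong; subst)

data IsUnit : 𝔾 → Set where
  𝟙-unit  : IsUnit 𝟙
  -𝟙-unit : IsUnit -𝟙
  𝕚-unit  : IsUnit 𝕚
  -𝕚-unit : IsUnit -𝕚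

normSq-unit : ∀ {z} → IsUnit z → normSq z ≡ 1
normSq-unit 𝟙-unit  = refl
normSq-unit -𝟙-unit = refl
normSq-unit 𝕚-unit  = refl
normSq-unit -𝕚-unit = refl

normSq≤1⇒zero⊎unit : ∀ z → normSq z ≤ 1 → z ≡ 𝟘 ⊎ IsUnit z
normSq≤1⇒zero⊎unit (+ zero        + + zero i)        _ = inj₁ refl
normSq≤1⇒zero⊎unit (+ zero        + + suc zero i)    _ = inj₂ 𝕚-unit
normSq≤1⇒zero⊎unit (+ zero        + -[1+ zero ] i)   _ = inj₂ -𝕚-unit
normSq≤1⇒zero⊎unit (+ suc zero    + + zero i)        _ = inj₂ 𝟙-unit
normSq≤1⇒zero⊎unit (-[1+ zero ]   + + zero i)        _ = inj₂ -𝟙-unit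
normSq≤1⇒zero⊎unit (+ zero        + + suc (suc _) i) (s≤s ())
normSq≤1⇒zero⊎unit (+ zero        + -[1+ suc _ ] i)  (s≤s ())
normSq≤1⇒zero⊎unit (+ suc zero    + + suc _ i)       (s≤s ())
normSq≤1⇒zero⊎unit (+ suc zero    + -[1+ _ ] i)      (s≤s ())
normSq≤1⇒zero⊎unit (+ suc (suc _) + _ i)             (s≤s ())
normSq≤1⇒zero⊎unit (-[1+ zero ]   + + suc _ i)       (s≤s ())
normSq≤1⇒zero⊎unit (-[1+ zero ]   + -[1+ _ ] i)      (s≤s ())
normSq≤1⇒zero⊎unit (-[1+ suc _ ]  + _ i)             (s≤s ())

nonzero⇒normSq-pos : ∀ z → z ≢ 𝟘 → 1 ≤ normSq z
nonzero⇒normSq-pos z z≢𝟘 with normSq z in eq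
... | suc _ = s≤s z≤n
... | zero with normSq≤1⇒zero⊎unit z (subst (_≤ 1) (sym eq) z≤n)
...   | inj₁ z≡𝟘 = ⊥-elim (z≢𝟘 z≡𝟘)
...   | inj₂ u with () ← trans (sym (normSq-unit u)) eq

iter-fixed : {A : Set} {f : A → A} {x : A} → f x ≡ x → ∀ k → iter f k x ≡ x
iter-fixed         fx≡x zero    = refl
iter-fixed {f = f} fx≡x (suc k) = trans (cong f (iter-fixed fx≡x k)) fx≡x

S-𝟘 : ∀ B → S B 𝟘 ≡ 𝟘
S-𝟘 zero    = refl
S-𝟘 (suc _) = refl

reaches-𝟙⇒nonzero : ∀ B h {w} → iter (S B) h w ≡ 𝟙 → w ≢ 𝟘
reaches-𝟙⇒nonzero B h reaches refl with () ← trans (sym (iter-fixed (S-𝟘 B) h)) reaches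

height-unique : ∀ {B z h h′} → HasHeight B z h → HasHeight B z h′ → h ≡ h′
height-unique {h = h} {h′} (reaches , least) (reaches′ , least′) with <-cmp h h′
... | tri< h<h′ _ _ = ⊥-elim (least′ h h<h′ reaches)
... | tri≈ _ h≡h′ _ = h≡h′
... | tri> _ _ h′<h = ⊥-elim (least h′ h′<h reaches′)

module _ (b : ℕ) where
  private
    B : ℕ
    B = suc (suc b)

  -- S B 𝟙 reduces to 𝟙 because B ≥ 2.
  height⇒happy : ∀ {z h} → HasHeight B z h → Happy B z
  height⇒happy {h = h} (reaches , _) = suc h , s≤s z≤n , cong (S B) reaches

  unitHeight : ∀ {z} → IsUnit z → ℕ
  unitHeight 𝟙-unit  = 0
  unitHeight -𝟙-unit = 1
  unitHeight 𝕚-unit  = 2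
  unitHeight -𝕚-unit = 2

  unit-height : ∀ {z} (u : IsUnit z) → HasHeight B z (unitHeight u)
  unit-height 𝟙-unit  = refl , λ _ ()
  unit-height -𝟙-unit = refl , λ { zero _ () ; (suc _) (s≤s ()) _ }
  unit-height 𝕚-unit  = refl , λ { zero _ () ; (suc zero) _ () ; (suc (suc _)) (s≤s (s≤s ())) _ }
  unit-height -𝕚-unit = refl , λ { zero _ () ; (suc zero) _ () ; (suc (suc _)) (s≤s (s≤s ())) _ }

  UnitOfHeight : ℕ → 𝔾 → Set
  UnitOfHeight h z = Σ (IsUnit z) λ u → unitHeight u ≡ h

  unitOfHeight⇒height : ∀ {h z} → UnitOfHeight h z → HasHeight B z h
  unitOfHeight⇒height (u , refl) = unit-height u

  smallest⇔unitOfHeight : ∀ {h c} → UnitOfHeight h c →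
    ∀ z → SmallestOfHeight B h z ⇔ UnitOfHeight h z
  smallest⇔unitOfHeight {h} {c} c-unitOfHeight@(c-unit , _) z = mk⇔ to from
    where
    c-height : HasHeight B c h
    c-height = unitOfHeight⇒height c-unitOfHeight

    to : SmallestOfHeight B h z → UnitOfHeight h z
    to (_ , z-height@(z-reaches , _) , minimal)
      with normSq≤1⇒zero⊎unit z
             (subst (normSq z ≤_) (normSq-unit c-unit) (minimal c (height⇒happy c-height) c-height))
    ... | inj₁ z≡𝟘 = ⊥-elim (reaches-𝟙⇒nonzero B h z-reaches z≡𝟘)
    ... | inj₂ u   = u , height-unique (unit-height u) z-height

    from : UnitOfHeight h z → SmallestOfHeight B h z
    from z-unitOfHeight@(u , _) =
      height⇒happy z-height , z-height , λ w _ (w-reaches , _) →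
        subst (_≤ normSq w) (sym (normSq-unit u))
          (nonzero⇒normSq-pos w (reaches-𝟙⇒nonzero B h w-reaches))
      where
      z-height : HasHeight B z h
      z-height = unitOfHeight⇒height z-unitOfHeight

theorem8 : (B : ℕ) → 2 ≤ B →
    (∀ z → SmallestOfHeight B 0 z ⇔ z ≡ 𝟙) ×
    (∀ z → SmallestOfHeight B 1 z ⇔ z ≡ -𝟙) ×
    (∀ z → SmallestOfHeight B 2 z ⇔ (z ≡ 𝕚 ⊎ z ≡ -𝕚))
theorem8 (suc (suc b)) (s≤s (s≤s _)) =
  (λ z → mk⇔ (λ { (𝟙-unit , refl) → refl }) (λ { refl → 𝟙-unit , refl })
           ⇔-∘ smallest⇔unitOfHeight b (𝟙-unit , refl) z) ,
  (λ z → mk⇔ (λ { (-𝟙-unit , refl) → refl }) (λ { refl → -𝟙-unit , refl })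
           ⇔-∘ smallest⇔unitOfHeight b (-𝟙-unit , refl) z) ,
  (λ z → mk⇔ (λ { (𝕚-unit , refl) → inj₁ refl ; (-𝕚-unit , refl) → inj₂ refl })
             (λ { (inj₁ refl) → 𝕚-unit , refl ; (inj₂ refl) → -𝕚-unit , refl })
           ⇔-∘ smallest⇔unitOfHeight b (𝕚-unit , refl) z)
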